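{- For integers $n\ge 2$ and $1\le k\le n-1$, let $H_k(n) := 1+\sum_{i=1}^{n-1}\frac{(n+i-1-k)!}{i!}\,i^k$. Then for all integers $n\ge 2$, $k\ge 2$ with $n\ge k+1$, we have $H_k(n)<H_{k-1}(n)$. -}

module Defs where

open import Data.Nat as ℕ using (ℕ; zero; suc; _∸_; _^_; _!)
open import Data.Nat.Properties using (_!≢0)
open import Data.Integer using (+_)
open import Data.Rational as ℚ using (ℚ; _/_)

-- term i of the sum: (n + i - 1 - k)! / i! * i^k   (as a rational number)
-- (for n ≥ k+1 and i ≥ 1 the truncated subtraction never truncates)
term : ℕ → ℕ → ℕ → ℚ
term k n i = (+ (((n ℕ.+ i) ∸ 1 ∸ k) ! ℕ.* (i ^ k))) / (i !)
  where instance _ = i !≢0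

sumFrom1 : ℕ → (ℕ → ℚ) → ℚ
sumFrom1 zero    f = ℚ.0ℚ
sumFrom1 (suc m) f = sumFrom1 m f ℚ.+ f (suc m)

H : ℕ → ℕ → ℚ
H k n = ℚ.1ℚ ℚ.+ sumFrom1 (n ∸ 1) (term k n)

-- The comparison is termwise.  Write n = k + 2 + j, the smaller index being
-- k + 1, and fix a summation index i + 1.  With X = j + i + 1 the two terms are
--
--   term (k+1) n (i+1) = X!       · (i+1)^(k+1) / (i+1)!
--   term  k    n (i+1) = (X + 1)! · (i+1)^k     / (i+1)!
--
-- so their ratio is (i+1)/(X+1) < 1.  The file therefore establishes
--   * the index arithmetic identifying both factorial arguments,
--   * the numerator inequality X! · (i · p) < (X+1)! · p for i < X + 1,
--   * strict monotonicity of a fraction in its numerator,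
--   * strict monotonicity of the finite sum sumFrom1 under termwise <,
-- and the theorem follows by adding 1 to both sides of the sum comparison.
module Submission where

open import Defs
open import Data.Nat using (ℕ; _≤_; suc; pred)
open import Data.Rational using (_<_)

open import Data.Nat as ℕ using (zero; _+_; _*_; _∸_; _^_; _!; s≤s)
import Data.Nat.Properties as ℕ
open import Data.Integer as ℤ using (+_)
import Data.Integer.Properties as ℤ
import Data.Rational as ℚ
import Data.Rational.Properties as ℚ
open import Data.Rational.Unnormalised as ℚᵘ using (mkℚᵘ)
import Data.Rational.Unnormalised.Properties as ℚᵘ
open import Data.Product using (_,_)
open import Relation.Binary.PropositionalEquality
open ≡-Reasoning

/-monoˡ-< : ∀ a b d .{{_ : ℕ.NonZero d}} → a ℕ.< b → (+ a) ℚ./ d < (+ b) ℚ./ d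
/-monoˡ-< a b (suc d) a<b = ℚ.toℚᵘ-cancel-<
  (ℚᵘ.<-respʳ-≃ (unnormalise b) (ℚᵘ.<-respˡ-≃ (unnormalise a)
    (ℚᵘ.*<* (ℤ.*-monoʳ-<-pos (+ suc d) (ℤ.+<+ a<b)))))
  where
  unnormalise : ∀ m → mkℚᵘ (+ m) d ℚᵘ.≃ ℚ.toℚᵘ ((+ m) ℚ./ suc d)
  unnormalise m = ℚᵘ.≃-sym (ℚ.toℚᵘ-fromℚᵘ (mkℚᵘ (+ m) d))

factorial-step-< : ∀ X i p → 0 ℕ.< p → i ℕ.< suc X →
                   X ! * (i * p) ℕ.< suc X ! * p
factorial-step-< X i p p>0 i<1+X =
  subst₂ ℕ._<_ reassocˡ reassocʳ (ℕ.*-monoˡ-< (X ! * p) {{X!p≢0}} i<1+X)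
  where
  X!p≢0 : ℕ.NonZero (X ! * p)
  X!p≢0 = ℕ.>-nonZero (ℕ.*-mono-< (ℕ.>-nonZero⁻¹ (X !) {{X ℕ.!≢0}}) p>0)
  reassocˡ : i * (X ! * p) ≡ X ! * (i * p)
  reassocˡ = begin
    i * (X ! * p)  ≡⟨ ℕ.*-assoc i (X !) p ⟨
    i * X ! * p    ≡⟨ cong (_* p) (ℕ.*-comm i (X !)) ⟩
    X ! * i * p    ≡⟨ ℕ.*-assoc (X !) i p ⟩
    X ! * (i * p)  ∎
  reassocʳ : suc X * (X ! * p) ≡ suc X ! * p
  reassocʳ = sym (ℕ.*-assoc (suc X) (X !) p)

factorial-arg-lower : ∀ k j i → suc (suc (k + j)) + suc i ∸ 1 ∸ suc k ≡ j + suc i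
factorial-arg-lower k j i = begin
  k + j + suc i ∸ k    ≡⟨ cong (_∸ k) (ℕ.+-assoc k j (suc i)) ⟩
  k + (j + suc i) ∸ k  ≡⟨ ℕ.m+n∸m≡n k (j + suc i) ⟩
  j + suc i            ∎

factorial-arg-upper : ∀ k j i → suc (suc (k + j)) + suc i ∸ 1 ∸ k ≡ suc (j + suc i)
factorial-arg-upper k j i = begin
  suc (k + j + suc i) ∸ k    ≡⟨ cong (λ m → suc m ∸ k) (ℕ.+-assoc k j (suc i)) ⟩
  suc (k + (j + suc i)) ∸ k  ≡⟨ cong (_∸ k) (ℕ.+-suc k (j + suc i)) ⟨
  k + suc (j + suc i) ∸ k    ≡⟨ ℕ.m+n∸m≡n k (suc (j + suc i)) ⟩
  suc (j + suc i)            ∎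

term-< : ∀ k j i → term (suc k) (suc (suc (k + j))) (suc i)
                 < term k (suc (suc (k + j))) (suc i)
term-< k j i rewrite factorial-arg-lower k j i | factorial-arg-upper k j i =
  /-monoˡ-< _ _ (suc i !) {{suc i ℕ.!≢0}}
    (factorial-step-< (j + suc i) (suc i) (suc i ^ k)
      (ℕ.m^n>0 (suc i) k) (s≤s (ℕ.m≤n+m (suc i) j)))

sumFrom1-mono-< : ∀ m (f g : ℕ → ℚ.ℚ) → (∀ i → f (suc i) < g (suc i)) →
                  sumFrom1 (suc m) f < sumFrom1 (suc m) g
sumFrom1-mono-< zero    f g f<g = ℚ.+-mono-≤-< (ℚ.≤-refl {ℚ.0ℚ}) (f<g 0)
sumFrom1-mono-< (suc m) f g f<g = ℚ.+-mono-< (sumFrom1-mono-< m f g f<g) (f<g (suc m))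

H-step-< : ∀ k j → H (suc k) (suc (suc (k + j))) < H k (suc (suc (k + j)))
H-step-< k j = ℚ.+-mono-≤-< (ℚ.≤-refl {ℚ.1ℚ}) (sumFrom1-mono-< (k + j) _ _ (term-< k j))

mainTheorem5 : (n k : ℕ) → 2 ≤ n → 2 ≤ k → suc k ≤ n → H k n < H (pred k) n
mainTheorem5 n (suc k) _ _ k+2≤n with ℕ.m≤n⇒∃[o]m+o≡n k+2≤n
... | j , refl = H-step-< k j
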